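{- For a positive integer $n$, the graph $H_{2n+1,2n+3}\times C_4$ is distance magic if and only if $n=1$ (i.e. $2n+3=5$), where $H_{2n+1,2n+3}$ is the graph on vertices $v_0,\dots,v_{2n+2}$ in which $v_0$ is adjacent to all other vertices and, for $1\le i<j\le 2n+2$, $v_i\sim v_j$ iff $j\ne i+n+1$.
   Context: The direct (tensor) product $G\times H$ has vertex set $V(G)\times V(H)$, with $(g,h)\sim(g',h')$ iff $gg'\in E(G)$ and $hh'\in E(H)$. A distance magic labeling of a graph on $N$ vertices is a bijection $f:V\to\{1,\dots,N\}$ such that $\sum_{v\in N(u)}f(v)$ is the same for all vertices $u$; a graph is distance magic if it has one. The given graph is the Harary graph $H_{2n+1,2n+3}$. -}

module Defs where

open import Data.Nat using (ℕ; zero; suc; _+_; _*_; _∸_; _≡ᵇ_)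
open import Data.Nat.Properties using ()
open import Data.Bool using (Bool; true; false; _∧_; _∨_; not; if_then_else_)
open import Data.Fin using (Fin; toℕ; quotient; remainder)
open import Data.List using (List; map; allFin)
open import Data.Nat.ListAction using (sum)
open import Data.Product using (Σ; ∃; _×_; _,_)
open import Relation.Binary.PropositionalEquality using (_≡_)
open import Function.Definitions using (Bijective)

record Graph : Set where
  field
    size : ℕ
    adj  : Fin size → Fin size → Bool
open Graph public

dist : ℕ → ℕ → ℕ
dist a b = (a ∸ b) + (b ∸ a)

neighbourSum : (G : Graph) → (Fin (size G) → ℕ) → Fin (size G) → ℕ
neighbourSum G f u = sum (map (λ v → if adj G u v then f v else 0) (allFin (size G)))

-- Distance magic: a bijection f : V → {1,…,N} (encoded as v ↦ toℕ (ℓ v) + 1 with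
-- ℓ : Fin N → Fin N bijective) whose neighbourhood sums are all equal.
DistanceMagic : Graph → Set
DistanceMagic G =
  Σ (Fin (size G) → Fin (size G)) λ ℓ →
    Bijective _≡_ _≡_ ℓ ×
    ∃ λ k → ∀ u → neighbourSum G (λ v → suc (toℕ (ℓ v))) u ≡ k

-- Direct (tensor) product: vertex set Fin (|G| * |H|) ≅ Fin |G| × Fin |H|
-- (via quotient/remainder), (g,h) ~ (g',h') iff gg' ∈ E(G) and hh' ∈ E(H).
_×ᴳ_ : Graph → Graph → Graph
G ×ᴳ H = record
  { size = size G * size H
  ; adj  = λ x y → adj G (quotient (size H) x) (quotient (size H) y)
                 ∧ adj H (remainder {size G} (size H) x) (remainder {size G} (size H) y)
  }

cycle : ℕ → Graph
cycle m = record
  { size = m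
  ; adj  = λ i j → let a = toℕ i ; b = toℕ j in
                   (dist a b ≡ᵇ 1) ∨ ((dist a b + 1) ≡ᵇ m)
  }

C₄ : Graph
C₄ = cycle 4

harary : ℕ → Graph
harary n = record
  { size = 2 * n + 3
  ; adj  = λ i j → let a = toℕ i ; b = toℕ j in
                   not (a ≡ᵇ b) ∧ ((a ≡ᵇ 0) ∨ (b ≡ᵇ 0) ∨ not (dist a b ≡ᵇ suc n))
  }

-- On a vertex (g , c) of H × C₄ the neighbourhood sum of a labelling f is the neighbourhood
-- sum in H of the weight g ↦ f (g , c + 1) + f (g , c − 1).  A distance magic labelling of
-- H_{2n+1,2n+3} × C₄ therefore gives two weights on H_{2n+1,2n+3} with the same constant
-- neighbourhood sum k.  There the centre v₀ misses only itself and every other vertex misses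
-- only itself and its antipode, so each antipodal pair weighs w(v₀), k = (n + 1) w(v₀) and the
-- total weight is (n + 2) w(v₀); in particular both weights agree at v₀.  Comparing the total
-- with 1 + 2 + ⋯ + N for N = 4 (2n + 3) gives (n + 2) w(v₀) = (2n + 3)(8n + 13), which is
-- 3 modulo n + 2, so n + 2 ∣ 3.  For n = 1 an explicit labelling is checked by evaluation.
module Submission where

open import Defs
open import Data.Bool.Properties using (∨-∧-booleanAlgebra)
open import Data.Nat.Properties
open import Algebra.Lattice.Properties.BooleanAlgebra ∨-∧-booleanAlgebra using (deMorgan₂)
open import Algebra.Properties.CommutativeMonoid.Sum +-0-commutativeMonoid
  using (sum-syntax; ∑-distrib-+; sum-cong-≗; sum-replicate-zero; sum-permute)
open import Data.Bool using (Bool; true; false; T; not; _∧_; _∨_; if_then_else_)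
open import Data.Fin using (Fin; zero; suc; toℕ; fromℕ<; combine; _↑ˡ_; _↑ʳ_; #_)
open import Data.Fin.Properties using (all?; toℕ-fromℕ<; toℕ-↑ˡ; toℕ-↑ʳ; toℕ≤pred[n]; remQuot-combine)
  renaming (_≟_ to _≟ᶠ_)
open import Data.List using (map; allFin; tabulate)
open import Data.List.Properties using (map-tabulate; map-cong)
open import Data.Nat using (ℕ; zero; suc; _+_; _*_; _∸_; _≤_; _<_; _≡ᵇ_; ∣_-_∣; z≤n; s≤s; s≤s⁻¹)
open import Data.Nat.Divisibility using (_∣_; ∣m+n∣m⇒∣n; m∣m*n; ∣⇒≤)
open import Data.Nat.ListAction using (sum)
open import Data.Nat.Tactic.RingSolver using (solve-∀)
open import Data.Product using (_,_; proj₁; proj₂)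
open import Data.Sum using (inj₁; inj₂)
open import Data.Unit using (tt)
open import Data.Vec using (lookup; _∷_; [])
open import Function using (_∘_; id; _⇔_; mk⇔)
open import Function.Bundles using (mk⤖)
open import Function.Definitions using (Bijective; Injective; Surjective)
open import Function.Properties.Bijection using (⤖⇒↔)
open import Relation.Binary.PropositionalEquality
open import Relation.Nullary.Decidable using (does-⇔; dec-false; toWitness)
open import Relation.Nullary.Negation using (contradiction)

∑-allFin : ∀ m (f : Fin m → ℕ) → sum (map f (allFin m)) ≡ ∑[ i < m ] f i
∑-allFin m f = trans (cong sum (map-tabulate id f)) (sum-tabulate m f)
  where
  sum-tabulate : ∀ m (f : Fin m → ℕ) → sum (tabulate f) ≡ ∑[ i < m ] f i
  sum-tabulate zero    f = refl
  sum-tabulate (suc m) f = cong (f zero +_) (sum-tabulate m (f ∘ suc))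

∑-const : ∀ m x → ∑[ i < m ] x ≡ m * x
∑-const zero    x = refl
∑-const (suc m) x = cong (x +_) (∑-const m x)

∑-split : ∀ m {n} (f : Fin (m + n) → ℕ) →
          ∑[ i < m + n ] f i ≡ ∑[ i < m ] f (i ↑ˡ n) + ∑[ j < n ] f (m ↑ʳ j)
∑-split zero    f = refl
∑-split (suc m) f = trans (cong (f zero +_) (∑-split m (f ∘ suc))) (sym (+-assoc (f zero) _ _))

∑-combine : ∀ m n (f : Fin (m * n) → ℕ) →
            ∑[ k < m * n ] f k ≡ ∑[ i < m ] ∑[ j < n ] f (combine i j)
∑-combine zero    n f = refl
∑-combine (suc m) n f =
  trans (∑-split n f) (cong (∑[ j < n ] f (j ↑ˡ m * n) +_) (∑-combine m n (f ∘ (n ↑ʳ_))))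

∑-bijection : ∀ {m} {ℓ : Fin m → Fin m} → Bijective _≡_ _≡_ ℓ →
              (g : Fin m → ℕ) → ∑[ i < m ] g (ℓ i) ≡ ∑[ i < m ] g i
∑-bijection ℓ-bij g = sym (sum-permute g (⤖⇒↔ (mk⤖ ℓ-bij)))

∑-toℕ-suc : ∀ m → 2 * ∑[ i < m ] suc (toℕ i) ≡ m * suc m
∑-toℕ-suc zero    = refl
∑-toℕ-suc (suc m) = begin
  2 * (1 + ∑[ i < m ] (1 + suc (toℕ i)))
    ≡⟨ cong (λ s → 2 * (1 + s)) (∑-distrib-+ {m} (λ _ → 1) (λ i → suc (toℕ i))) ⟩
  2 * (1 + (∑[ i < m ] 1 + S))
    ≡⟨ cong (λ s → 2 * (1 + (s + S))) (trans (∑-const m 1) (*-identityʳ m)) ⟩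
  2 * (1 + (m + S))
    ≡⟨ expand m S ⟩
  2 + 2 * m + 2 * S
    ≡⟨ cong (2 + 2 * m +_) (∑-toℕ-suc m) ⟩
  2 + 2 * m + m * suc m
    ≡⟨ factor m ⟩
  suc m * suc (suc m) ∎
  where
  open ≡-Reasoning
  S = ∑[ i < m ] suc (toℕ i)
  expand : ∀ m S → 2 * (1 + (m + S)) ≡ 2 + 2 * m + 2 * S
  expand = solve-∀
  factor : ∀ m → 2 + 2 * m + m * suc m ≡ suc m * suc (suc m)
  factor = solve-∀

∑-if-∧ : ∀ m b (c : Fin m → Bool) (f : Fin m → ℕ) →
         ∑[ i < m ] (if b ∧ c i then f i else 0) ≡ (if b then ∑[ i < m ] (if c i then f i else 0) else 0)
∑-if-∧ m true  c f = refl
∑-if-∧ m false c f = sum-replicate-zero m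

∑-δ : ∀ m (a : ℕ → ℕ) {c} → c < m → ∑[ j < m ] (if toℕ j ≡ᵇ c then a (toℕ j) else 0) ≡ a c
∑-δ (suc m) a {zero}  _         = trans (cong (a 0 +_) (sum-replicate-zero m)) (+-identityʳ (a 0))
∑-δ (suc m) a {suc c} (s≤s c<m) = ∑-δ m (a ∘ suc) c<m

if-∨-disjoint : ∀ {c d} x y → c ≢ d →
  (if (x ≡ᵇ c) ∨ (x ≡ᵇ d) then y else 0) ≡ (if x ≡ᵇ c then y else 0) + (if x ≡ᵇ d then y else 0)
if-∨-disjoint {c} {d} x y c≢d with x ≡ᵇ c in x≡ᵇc
... | false = refl
... | true with refl ← ≡ᵇ⇒≡ x c (subst T (sym x≡ᵇc) tt)
  rewrite dec-false (x ≟ d) c≢d = sym (+-identityʳ y)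

∑-δ₂ : ∀ m (a : ℕ → ℕ) {c d} → c ≢ d → c < m → d < m →
       ∑[ j < m ] (if (toℕ j ≡ᵇ c) ∨ (toℕ j ≡ᵇ d) then a (toℕ j) else 0) ≡ a c + a d
∑-δ₂ m a {c} {d} c≢d c<m d<m = begin
  ∑[ j < m ] (if (toℕ j ≡ᵇ c) ∨ (toℕ j ≡ᵇ d) then a (toℕ j) else 0)
    ≡⟨ sum-cong-≗ {m} (λ j → if-∨-disjoint (toℕ j) (a (toℕ j)) c≢d) ⟩
  ∑[ j < m ] (δ c j + δ d j)
    ≡⟨ ∑-distrib-+ {m} (δ c) (δ d) ⟩
  ∑[ j < m ] δ c j + ∑[ j < m ] δ d j
    ≡⟨ cong₂ _+_ (∑-δ m a c<m) (∑-δ m a d<m) ⟩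
  a c + a d ∎
  where
  open ≡-Reasoning
  δ : ℕ → Fin m → ℕ
  δ e j = if toℕ j ≡ᵇ e then a (toℕ j) else 0

≡ᵇ-sym : ∀ i j → (i ≡ᵇ j) ≡ (j ≡ᵇ i)
≡ᵇ-sym i j = does-⇔ (mk⇔ sym sym) (i ≟ j) (j ≟ i)

dist≡∣-∣ : ∀ i j → dist i j ≡ ∣ i - j ∣
dist≡∣-∣ zero    zero    = refl
dist≡∣-∣ zero    (suc j) = refl
dist≡∣-∣ (suc i) zero    = +-identityʳ (suc i)
dist≡∣-∣ (suc i) (suc j) = dist≡∣-∣ i j

dist≡ᵇ : ∀ {i d} j → i < d → (dist i j ≡ᵇ d) ≡ (j ≡ᵇ i + d)
dist≡ᵇ {i} {d} j i<d = does-⇔ (mk⇔ to from) (dist i j ≟ d) (j ≟ i + d)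
  where
  to : dist i j ≡ d → j ≡ i + d
  to eq with ≤-total i j
  ... | inj₁ i≤j = trans (sym (m+[n∸m]≡n i≤j)) (cong (i +_) eq′)
    where
    eq′ : j ∸ i ≡ d
    eq′ = trans (sym (m≤n⇒∣m-n∣≡n∸m i≤j)) (trans (sym (dist≡∣-∣ i j)) eq)
  ... | inj₂ j≤i = contradiction (subst (_≤ i) eq′ (m∸n≤m i j)) (<⇒≱ i<d)
    where
    eq′ : i ∸ j ≡ d
    eq′ = trans (sym (m≤n⇒∣n-m∣≡n∸m j≤i)) (trans (sym (dist≡∣-∣ i j)) eq)
  from : j ≡ i + d → dist i j ≡ d
  from refl = trans (dist≡∣-∣ i (i + d)) (∣m-m+n∣≡n i d)

if-not+if : ∀ b x → (if not b then x else 0) + (if b then x else 0) ≡ x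
if-not+if true  x = refl
if-not+if false x = +-identityʳ x

adj-×ᴳ-combine : ∀ G H (g g′ : Fin (size G)) (h h′ : Fin (size H)) →
                 adj (G ×ᴳ H) (combine g h) (combine g′ h′) ≡ adj G g g′ ∧ adj H h h′
adj-×ᴳ-combine G H g g′ h h′ =
  cong₂ _∧_ (cong₂ (adj G) (cong proj₁ (remQuot-combine g h)) (cong proj₁ (remQuot-combine g′ h′)))
            (cong₂ (adj H) (cong proj₂ (remQuot-combine g h)) (cong proj₂ (remQuot-combine g′ h′)))

neighbourSum-∑ : ∀ G (f : Fin (size G) → ℕ) u →
                 neighbourSum G f u ≡ ∑[ v < size G ] (if adj G u v then f v else 0)
neighbourSum-∑ G f u = ∑-allFin (size G) _

neighbourSum-cong : ∀ G {f g : Fin (size G) → ℕ} → (∀ v → f v ≡ g v) →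
                    ∀ u → neighbourSum G f u ≡ neighbourSum G g u
neighbourSum-cong G f≗g u =
  cong sum (map-cong (λ v → cong (if adj G u v then_else 0) (f≗g v)) (allFin (size G)))

neighbourSum-×ᴳ : ∀ G H (f : Fin (size G * size H) → ℕ) g h →
  neighbourSum (G ×ᴳ H) f (combine g h) ≡
  neighbourSum G (λ g′ → neighbourSum H (λ h′ → f (combine g′ h′)) h) g
neighbourSum-×ᴳ G H f g h = begin
  neighbourSum (G ×ᴳ H) f (combine g h)
    ≡⟨ neighbourSum-∑ (G ×ᴳ H) f _ ⟩
  ∑[ x < size G * size H ] (if adj (G ×ᴳ H) (combine g h) x then f x else 0)
    ≡⟨ ∑-combine (size G) (size H) _ ⟩
  ∑[ g′ < size G ] ∑[ h′ < size H ]
    (if adj (G ×ᴳ H) (combine g h) (combine g′ h′) then f (combine g′ h′) else 0)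
    ≡⟨ sum-cong-≗ {size G} fibre ⟩
  ∑[ g′ < size G ] (if adj G g g′ then ∑[ h′ < size H ] (if adj H h h′ then f (combine g′ h′) else 0) else 0)
    ≡⟨ sum-cong-≗ {size G} (λ g′ → cong (if adj G g g′ then_else 0) (neighbourSum-∑ H (f ∘ combine g′) h)) ⟨
  ∑[ g′ < size G ] (if adj G g g′ then neighbourSum H (f ∘ combine g′) h else 0)
    ≡⟨ neighbourSum-∑ G _ g ⟨
  neighbourSum G (λ g′ → neighbourSum H (f ∘ combine g′) h) g ∎
  where
  open ≡-Reasoning
  fibre : ∀ g′ → ∑[ h′ < size H ] (if adj (G ×ᴳ H) (combine g h) (combine g′ h′) then f (combine g′ h′) else 0)
               ≡ (if adj G g g′ then ∑[ h′ < size H ] (if adj H h h′ then f (combine g′ h′) else 0) else 0)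
  fibre g′ = trans (sum-cong-≗ {size H} (λ h′ → cong (if_then f (combine g′ h′) else 0)
                                                     (adj-×ᴳ-combine G H g g′ h h′)))
                   (∑-if-∧ (size H) (adj G g g′) (adj H h) (f ∘ combine g′))

neighbourSum-complement : ∀ G (f : Fin (size G) → ℕ) u (P : Fin (size G) → Bool) →
  (∀ v → adj G u v ≡ not (P v)) →
  neighbourSum G f u + ∑[ v < size G ] (if P v then f v else 0) ≡ ∑[ v < size G ] f v
neighbourSum-complement G f u P adj≡ = begin
  neighbourSum G f u + ∑[ v < size G ] (if P v then f v else 0)
    ≡⟨ cong (_+ _) (neighbourSum-∑ G f u) ⟩
  ∑[ v < size G ] (if adj G u v then f v else 0) + ∑[ v < size G ] (if P v then f v else 0)
    ≡⟨ ∑-distrib-+ {size G} _ _ ⟨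
  ∑[ v < size G ] ((if adj G u v then f v else 0) + (if P v then f v else 0))
    ≡⟨ sum-cong-≗ {size G} (λ v → trans (cong (λ b → (if b then f v else 0) + _) (adj≡ v))
                                         (if-not+if (P v) (f v))) ⟩
  ∑[ v < size G ] f v ∎
  where open ≡-Reasoning

neighbourSum-C₄-0 : ∀ (F : Fin 4 → ℕ) → neighbourSum C₄ F (# 0) ≡ F (# 1) + F (# 3)
neighbourSum-C₄-0 F = cong (F (# 1) +_) (+-identityʳ (F (# 3)))

neighbourSum-C₄-1 : ∀ (F : Fin 4 → ℕ) → neighbourSum C₄ F (# 1) ≡ F (# 0) + F (# 2)
neighbourSum-C₄-1 F = cong (F (# 0) +_) (+-identityʳ (F (# 2)))

module _ (G : Graph) (f : Fin (size G * 4) → ℕ) where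

  oddLayerSum evenLayerSum : Fin (size G) → ℕ
  oddLayerSum  g = f (combine g (# 1)) + f (combine g (# 3))
  evenLayerSum g = f (combine g (# 0)) + f (combine g (# 2))

  neighbourSum-×C₄-0 : ∀ g → neighbourSum (G ×ᴳ C₄) f (combine g (# 0)) ≡ neighbourSum G oddLayerSum g
  neighbourSum-×C₄-0 g = trans (neighbourSum-×ᴳ G C₄ f g (# 0))
                               (neighbourSum-cong G (λ g′ → neighbourSum-C₄-0 (f ∘ combine g′)) g)

  neighbourSum-×C₄-1 : ∀ g → neighbourSum (G ×ᴳ C₄) f (combine g (# 1)) ≡ neighbourSum G evenLayerSum g
  neighbourSum-×C₄-1 g = trans (neighbourSum-×ᴳ G C₄ f g (# 1))
                               (neighbourSum-cong G (λ g′ → neighbourSum-C₄-1 (f ∘ combine g′)) g)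

  ∑-layerSums : ∑[ x < size G * 4 ] f x ≡ ∑[ g < size G ] oddLayerSum g + ∑[ g < size G ] evenLayerSum g
  ∑-layerSums = begin
    ∑[ x < size G * 4 ] f x
      ≡⟨ ∑-combine (size G) 4 f ⟩
    ∑[ g < size G ] ∑[ h < 4 ] f (combine g h)
      ≡⟨ sum-cong-≗ {size G} (λ g → regroup (f (combine g (# 0))) (f (combine g (# 1)))
                                    (f (combine g (# 2))) (f (combine g (# 3)))) ⟩
    ∑[ g < size G ] (oddLayerSum g + evenLayerSum g)
      ≡⟨ ∑-distrib-+ {size G} oddLayerSum evenLayerSum ⟩
    ∑[ g < size G ] oddLayerSum g + ∑[ g < size G ] evenLayerSum g ∎
    where
    open ≡-Reasoning
    regroup : ∀ w x y z → w + (x + (y + (z + 0))) ≡ (x + z) + (w + y)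
    regroup = solve-∀

extendByZero : ∀ {m} → (Fin m → ℕ) → ℕ → ℕ
extendByZero {zero}  w _       = 0
extendByZero {suc m} w zero    = w zero
extendByZero {suc m} w (suc j) = extendByZero (w ∘ suc) j

extendByZero-toℕ : ∀ {m} (w : Fin m → ℕ) i → extendByZero w (toℕ i) ≡ w i
extendByZero-toℕ w zero    = refl
extendByZero-toℕ w (suc i) = extendByZero-toℕ (w ∘ suc) i

size-harary : ∀ n → 2 * n + 3 ≡ suc (suc n + suc n)
size-harary = solve-∀

harary-adj-centre : ∀ n (u v : Fin (size (harary n))) → toℕ u ≡ 0 →
                    adj (harary n) u v ≡ not (toℕ v ≡ᵇ 0)
harary-adj-centre n u v u≡0 rewrite u≡0 with toℕ v
... | zero  = refl
... | suc j = refl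

harary-adj-rim : ∀ n (u v : Fin (size (harary n))) {i} → toℕ u ≡ suc i → i ≤ n →
                 adj (harary n) u v ≡ not ((toℕ v ≡ᵇ suc i) ∨ (toℕ v ≡ᵇ suc i + suc n))
harary-adj-rim n u v {i} u≡ i≤n rewrite u≡ with toℕ v
... | zero  = refl
... | suc j = begin
  not (i ≡ᵇ j) ∧ not (dist i j ≡ᵇ suc n)
    ≡⟨ cong₂ (λ x y → not x ∧ not y) (≡ᵇ-sym i j) (dist≡ᵇ j (s≤s i≤n)) ⟩
  not (j ≡ᵇ i) ∧ not (j ≡ᵇ i + suc n)
    ≡⟨ deMorgan₂ (j ≡ᵇ i) (j ≡ᵇ i + suc n) ⟨
  not ((j ≡ᵇ i) ∨ (j ≡ᵇ i + suc n)) ∎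
  where open ≡-Reasoning

-- Weights on harary n are indexed by ℕ because Fin (2 * n + 3) has no definitional zero.
module _ (n : ℕ) (a : ℕ → ℕ) {k : ℕ} (magic : ∀ u → neighbourSum (harary n) (a ∘ toℕ) u ≡ k) where

  private
    m = suc n
    M = size (harary n)

    <-size : ∀ {c} → c ≤ m + m → c < M
    <-size {c} c≤ = subst (c <_) (sym (size-harary n)) (s≤s c≤)

    centre-sum : k + a 0 ≡ ∑[ v < M ] a (toℕ v)
    centre-sum = trans (cong₂ _+_ (sym (magic v₀)) (sym (∑-δ M a 0<M)))
                       (neighbourSum-complement (harary n) (a ∘ toℕ) v₀ (λ v → toℕ v ≡ᵇ 0)
                         (λ v → harary-adj-centre n v₀ v (toℕ-fromℕ< 0<M)))
      where
      0<M = <-size z≤n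
      v₀ = fromℕ< 0<M

    rim-sum : ∀ {i} → i ≤ n → k + (a (suc i) + a (suc i + m)) ≡ ∑[ v < M ] a (toℕ v)
    rim-sum {i} i≤n = trans (cong₂ _+_ (sym (magic u)) (sym (∑-δ₂ M a suc-i≢suc-i+m i<M i+m<M)))
                            (neighbourSum-complement (harary n) (a ∘ toℕ) u _
                              (λ v → harary-adj-rim n u v (toℕ-fromℕ< i<M) i≤n))
      where
      i<M = <-size (s≤s (≤-trans i≤n (m≤m+n n m)))
      i+m<M = <-size (s≤s (+-monoˡ-≤ m i≤n))
      u = fromℕ< i<M
      suc-i≢suc-i+m = m+1+n≢m (suc i) ∘ sym

    antipodal-sum : ∀ {i} → i ≤ n → a (suc i) + a (suc i + m) ≡ a 0
    antipodal-sum i≤n = +-cancelˡ-≡ k _ _ (trans (rim-sum i≤n) (sym centre-sum))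

    ∑-rim : ∑[ j < m + m ] a (suc (toℕ j)) ≡ m * a 0
    ∑-rim = begin
      ∑[ j < m + m ] a (suc (toℕ j))
        ≡⟨ ∑-split m (a ∘ suc ∘ toℕ) ⟩
      ∑[ i < m ] a (suc (toℕ (i ↑ˡ m))) + ∑[ i < m ] a (suc (toℕ (m ↑ʳ i)))
        ≡⟨ ∑-distrib-+ {m} (λ i → a (suc (toℕ (i ↑ˡ m)))) (λ i → a (suc (toℕ (m ↑ʳ i)))) ⟨
      ∑[ i < m ] (a (suc (toℕ (i ↑ˡ m))) + a (suc (toℕ (m ↑ʳ i))))
        ≡⟨ sum-cong-≗ {m} pair ⟩
      ∑[ i < m ] a 0
        ≡⟨ ∑-const m (a 0) ⟩
      m * a 0 ∎
      where
      open ≡-Reasoning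
      pair : ∀ i → a (suc (toℕ (i ↑ˡ m))) + a (suc (toℕ (m ↑ʳ i))) ≡ a 0
      pair i rewrite toℕ-↑ˡ i m | toℕ-↑ʳ m i | +-comm m (toℕ i) = antipodal-sum (toℕ≤pred[n] i)

    total-sum : ∑[ v < M ] a (toℕ v) ≡ a 0 + m * a 0
    total-sum = trans (cong (λ s → ∑[ v < s ] a (toℕ v)) (size-harary n)) (cong (a 0 +_) ∑-rim)

  harary-magic-constant : k ≡ suc n * a 0
  harary-magic-constant = +-cancelʳ-≡ (a 0) _ _ (trans centre-sum (trans total-sum (+-comm (a 0) _)))

  harary-magic-total : ∑[ v < size (harary n) ] a (toℕ v) ≡ suc (suc n) * a 0
  harary-magic-total = total-sum

2+n∣3 : ∀ n x → 2 * (suc (suc n) * x + suc (suc n) * x) ≡ (2 * n + 3) * 4 * suc ((2 * n + 3) * 4) →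
        suc (suc n) ∣ 3
2+n∣3 n x eq = ∣m+n∣m⇒∣n (subst (suc (suc n) ∣_) eq′ (m∣m*n x)) (m∣m*n (16 * n + 18))
  where
  lhs : ∀ n x → 2 * (suc (suc n) * x + suc (suc n) * x) ≡ 4 * (suc (suc n) * x)
  lhs = solve-∀
  rhs : ∀ n → (2 * n + 3) * 4 * suc ((2 * n + 3) * 4) ≡ 4 * (suc (suc n) * (16 * n + 18) + 3)
  rhs = solve-∀
  eq′ : suc (suc n) * x ≡ suc (suc n) * (16 * n + 18) + 3
  eq′ = *-cancelˡ-≡ _ _ 4 (trans (sym (lhs n x)) (trans eq (rhs n)))

harary×C₄-distanceMagic⇒n≤1 : ∀ n → DistanceMagic (harary n ×ᴳ C₄) → n ≤ 1
harary×C₄-distanceMagic⇒n≤1 n (ℓ , ℓ-bij , k , magic) = s≤s⁻¹ (s≤s⁻¹ (∣⇒≤ (2+n∣3 n (A 0) counting)))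
  where
  H = harary n
  N = size H * 4

  f : Fin N → ℕ
  f v = suc (toℕ (ℓ v))

  A B : ℕ → ℕ
  A = extendByZero (oddLayerSum H f)
  B = extendByZero (evenLayerSum H f)

  A-magic : ∀ u → neighbourSum H (A ∘ toℕ) u ≡ k
  A-magic u = trans (neighbourSum-cong H (extendByZero-toℕ _) u)
                    (trans (sym (neighbourSum-×C₄-0 H f u)) (magic _))

  B-magic : ∀ u → neighbourSum H (B ∘ toℕ) u ≡ k
  B-magic u = trans (neighbourSum-cong H (extendByZero-toℕ _) u)
                    (trans (sym (neighbourSum-×C₄-1 H f u)) (magic _))

  ∑-A : ∑[ g < size H ] oddLayerSum H f g ≡ suc (suc n) * A 0
  ∑-A = trans (sum-cong-≗ {size H} (sym ∘ extendByZero-toℕ _)) (harary-magic-total n A A-magic)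

  ∑-B : ∑[ g < size H ] evenLayerSum H f g ≡ suc (suc n) * B 0
  ∑-B = trans (sum-cong-≗ {size H} (sym ∘ extendByZero-toℕ _)) (harary-magic-total n B B-magic)

  A₀≡B₀ : A 0 ≡ B 0
  A₀≡B₀ = *-cancelˡ-≡ _ _ (suc n)
            (trans (sym (harary-magic-constant n A A-magic)) (harary-magic-constant n B B-magic))

  counting : 2 * (suc (suc n) * A 0 + suc (suc n) * A 0) ≡ N * suc N
  counting = begin
    2 * (suc (suc n) * A 0 + suc (suc n) * A 0)
      ≡⟨ cong (λ b → 2 * (suc (suc n) * A 0 + suc (suc n) * b)) A₀≡B₀ ⟩
    2 * (suc (suc n) * A 0 + suc (suc n) * B 0)
      ≡⟨ cong (2 *_) (cong₂ _+_ ∑-A ∑-B) ⟨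
    2 * (∑[ g < size H ] oddLayerSum H f g + ∑[ g < size H ] evenLayerSum H f g)
      ≡⟨ cong (2 *_) (∑-layerSums H f) ⟨
    2 * ∑[ x < N ] f x
      ≡⟨ cong (2 *_) (∑-bijection ℓ-bij (suc ∘ toℕ)) ⟩
    2 * ∑[ x < N ] suc (toℕ x)
      ≡⟨ ∑-toℕ-suc N ⟩
    N * suc N ∎
    where open ≡-Reasoning

labelling₁ labelling₁⁻¹ : Fin 20 → Fin 20
labelling₁ = lookup (# 15 ∷ # 19 ∷ # 18 ∷ # 14 ∷ # 3 ∷ # 0 ∷ # 8 ∷ # 17 ∷ # 1 ∷ # 11 ∷
                     # 12 ∷ # 6 ∷ # 7 ∷ # 9 ∷ # 13 ∷ # 5 ∷ # 2 ∷ # 10 ∷ # 16 ∷ # 4 ∷ [])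
labelling₁⁻¹ = lookup (# 5 ∷ # 8 ∷ # 16 ∷ # 4 ∷ # 19 ∷ # 15 ∷ # 11 ∷ # 12 ∷ # 6 ∷ # 13 ∷
                       # 17 ∷ # 9 ∷ # 10 ∷ # 14 ∷ # 3 ∷ # 0 ∷ # 18 ∷ # 7 ∷ # 2 ∷ # 1 ∷ [])

harary₁×C₄-distanceMagic : DistanceMagic (harary 1 ×ᴳ C₄)
harary₁×C₄-distanceMagic = labelling₁ , (injective , surjective) , 70 , magic
  where
  inverseˡ : ∀ y → labelling₁ (labelling₁⁻¹ y) ≡ y
  inverseˡ = toWitness {a? = all? (λ y → labelling₁ (labelling₁⁻¹ y) ≟ᶠ y)} tt
  inverseʳ : ∀ x → labelling₁⁻¹ (labelling₁ x) ≡ x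
  inverseʳ = toWitness {a? = all? (λ x → labelling₁⁻¹ (labelling₁ x) ≟ᶠ x)} tt
  injective : Injective _≡_ _≡_ labelling₁
  injective {x} {y} eq = trans (sym (inverseʳ x)) (trans (cong labelling₁⁻¹ eq) (inverseʳ y))
  surjective : Surjective _≡_ _≡_ labelling₁
  surjective y = labelling₁⁻¹ y , λ { refl → inverseˡ y }
  magic : ∀ u → neighbourSum (harary 1 ×ᴳ C₄) (λ v → suc (toℕ (labelling₁ v))) u ≡ 70
  magic = toWitness
    {a? = all? (λ u → neighbourSum (harary 1 ×ᴳ C₄) (λ v → suc (toℕ (labelling₁ v))) u ≟ 70)} tt

mainTheorem8 : (n : ℕ) → 1 ≤ n → DistanceMagic (harary n ×ᴳ C₄) ⇔ (n ≡ 1)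
mainTheorem8 n 1≤n =
  mk⇔ (λ magic → ≤-antisym (harary×C₄-distanceMagic⇒n≤1 n magic) 1≤n)
      (λ { refl → harary₁×C₄-distanceMagic })
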